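{- Let $k\ge2$, $n\ge2$, and for each $i=1,\dots,n$ let $1\le q_i\le k$, $f_i(x_i)\in P_1^{k,q_i}$, and $a_i\in E_k$ with $\gcd(a_i,k)=1$. Let $\vec q=(q_1,\dots,q_n)$. Then $$f(x_1,\dots,x_n)=[a_1f_1(x_1)+a_2f_2(x_2)+\dots+a_nf_n(x_n)]\bmod k$$ is a $\vec q H$-function.
   Context: $E_k=\{0,1,\dots,k-1\}$; $P_n^k$ is the set of all functions $E_k^n\to E_k$; $X_f$ is the set of variables of $f$. $Rng(h)$ is the number of distinct values of $h$, and $P_m^{k,q}$ is the set of functions in $P_m^k$ with $Rng=q$. A subfunction of $f$ with respect to $N\subseteq X_f$ is obtained by replacing each variable in $N$ by a constant from $E_k$. For a variable $x_i$, $Spr(x_i,f)=\{Rng(h): h$ a subfunction of $f$ with respect to $X_f\setminus\{x_i\}\}$. For $\vec q=(q_1,\dots,q_n)$, $1\le q_i\le k$, a function $f\in P_n^k$ is a $\vec q H$-function if $Spr(x_i,f)=\{q_i\}$ for every $i=1,\dots,n$. "$\bmod k$" denotes the residue in $E_k$. -}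

module Defs where

open import Data.Nat using (ℕ; zero; suc; _+_; _*_; NonZero)
open import Data.Nat.DivMod using (_mod_)
open import Data.Fin using (Fin; toℕ)
open import Data.Fin.Properties using (_≟_)
open import Data.List using (List; []; _∷_; map; concatMap; filter; length; allFin)
open import Data.List.Relation.Unary.Any using (any?)
open import Data.Vec using (Vec; []; _∷_; _[_]≔_; tabulate; lookup)
import Data.Vec as V
open import Data.Product using (∃; _×_)
open import Relation.Binary.PropositionalEquality using (_≡_)

-- E_k = Fin k ; P_n^k = functions E_k^n → E_k (arguments as vectors of length n)
P : ℕ → ℕ → Set
P n k = Vec (Fin k) n → Fin k

allVecs : (k m : ℕ) → List (Vec (Fin k) m)
allVecs k zero = [] ∷ []
allVecs k (suc m) = concatMap (λ a → map (a ∷_) (allVecs k m)) (allFin k)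

Rng : {k m : ℕ} → P m k → ℕ
Rng {k} {m} h = length (filter (λ y → any? (λ x → h x ≟ y) (allVecs k m)) (allFin k))

-- the subfunction of f w.r.t. X_f \ {x_i}: all variables other than x_i are
-- fixed to the constants in c (the i-th entry of c is ignored); the result
-- is a unary function of x_i.
subfun : {k n : ℕ} → P n k → Fin n → Vec (Fin k) n → P 1 k
subfun f i c (t ∷ []) = f (c [ i ]≔ t)

InSpr : {k n : ℕ} → ℕ → Fin n → P n k → Set
InSpr {k} q i f = ∃ λ c → Rng (subfun f i c) ≡ q

SprIsSingleton : {k n : ℕ} → P n k → Fin n → ℕ → Set
SprIsSingleton f i q = ∀ r → (InSpr r i f → r ≡ q) × (r ≡ q → InSpr r i f)

IsQH : {k n : ℕ} → (Fin n → ℕ) → P n k → Set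
IsQH {n = n} q f = ∀ (i : Fin n) → SprIsSingleton f i (q i)

linComb : {k n : ℕ} → .{{_ : NonZero k}} → (Fin n → Fin k) → (Fin n → P 1 k) → P n k
linComb {k} {n} a fs x =
  V.sum (tabulate (λ i → toℕ (a i) * toℕ (fs i (lookup x i ∷ [])))) mod k

-- With every variable except x_i fixed, f reduces to y ↦ (s + a_i y) mod k
-- applied to f_i(x_i), where s is the contribution of the fixed variables.
-- As a_i is invertible modulo k this outer map is a bijection of E_k, so the
-- subfunction takes exactly as many values as f_i, namely q_i.
module Submission where

open import Defs
open import Data.Nat using (ℕ; _≤_; _<_; NonZero; _+_; _*_; _∸_; _%_; _/_)
open import Data.Nat.Properties
  using (≤-antisym; ≤-<-trans; m∸n≤m; m∸n≡0⇒m≤n; +-comm; +-assoc; [m+n]∸[m+o]≡n∸o; *-distribʳ-∸; *-distribˡ-∸)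
open import Data.Nat.DivMod using (_mod_; m≡m%n+[m/n]*n; m%n<n; m<n⇒m%n≡m)
open import Data.Nat.Divisibility using (_∣_; divides; n∣m⇒m%n≡0)
open import Data.Nat.Coprimality using (Coprime; gcd≡1⇒coprime; coprime-divisor)
import Data.Nat.Coprimality as Coprime
open import Data.Nat.GCD using (gcd)
open import Data.Fin using (Fin; toℕ; zero; suc)
open import Data.Fin.Properties using (_≟_; injective⇒≤; toℕ<n; toℕ-injective; fromℕ<-injective)
open import Data.List using (List; filter; length; allFin; lookup)
open import Data.List.Relation.Unary.Any as Any using (Any; index; any?)
open import Data.List.Relation.Unary.Any.Properties using (lookup-index)
import Data.List.Relation.Unary.All as All
open import Data.List.Relation.Unary.AllPairs using (_∷_)
open import Data.List.Relation.Unary.Unique.Propositional using (Unique)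
open import Data.List.Relation.Unary.Unique.Propositional.Properties using (filter⁺; allFin⁺)
open import Data.List.Membership.Propositional using (_∈_; lose; find)
open import Data.List.Membership.Propositional.Properties using (∈-filter⁺; ∈-filter⁻; ∈-allFin; ∈-lookup)
open import Data.Vec using (Vec; []; _∷_; _[_]≔_; tabulate; replicate)
import Data.Vec as Vec
open import Data.Product using (∃; _×_; _,_; proj₁; proj₂)
open import Data.Empty using (⊥-elim)
open import Function using (_∘_)
open import Function.Definitions using (Injective)
open import Relation.Unary using (Decidable)
open import Relation.Binary.PropositionalEquality using (_≡_; refl; sym; trans; cong; cong₂; subst; module ≡-Reasoning)

Unique-lookup-injective : ∀ {A : Set} {xs : List A} → Unique xs →
  ∀ i j → lookup xs i ≡ lookup xs j → i ≡ j
Unique-lookup-injective (_ ∷ _)      zero    zero    _  = refl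
Unique-lookup-injective (x∉ ∷ _)     zero    (suc j) eq = ⊥-elim (All.lookup x∉ (∈-lookup j) eq)
Unique-lookup-injective (x∉ ∷ _)     (suc i) zero    eq = ⊥-elim (All.lookup x∉ (∈-lookup i) (sym eq))
Unique-lookup-injective (_ ∷ unique) (suc i) (suc j) eq = cong suc (Unique-lookup-injective unique i j eq)

-- R only has to be injective, not functional, so it can be the converse of an
-- injection whose inverse is never constructed.
Unique⇒length-≤ : ∀ {A B : Set} {R : A → B → Set} {xs : List A} {ys : List B} →
  Unique xs →
  (∀ {x} → x ∈ xs → ∃ λ y → y ∈ ys × R x y) →
  (∀ {x x′ y} → R x y → R x′ y → x ≡ x′) →
  length xs ≤ length ys
Unique⇒length-≤ {R = R} {xs} {ys} unique related R-injective = injective⇒≤ image-injective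
  where
  image : Fin (length xs) → Fin (length ys)
  image i = index (proj₁ (proj₂ (related (∈-lookup i))))

  image-related : ∀ i → R (lookup xs i) (lookup ys (image i))
  image-related i with related (∈-lookup {xs = xs} i)
  ... | _ , y∈ys , r = subst (R (lookup xs i)) (lookup-index y∈ys) r

  image-injective : Injective _≡_ _≡_ image
  image-injective {i} {j} eq = Unique-lookup-injective unique i j
    (R-injective (image-related i) (subst (R (lookup xs j) ∘ lookup ys) (sym eq) (image-related j)))

module _ {k m : ℕ} where

  IsValue : P m k → Fin k → Set
  IsValue h y = Any (λ x → h x ≡ y) (allVecs k m)

  isValue? : (h : P m k) → Decidable (IsValue h)
  isValue? h y = any? (λ x → h x ≟ y) (allVecs k m)

  values : P m k → List (Fin k)
  values h = filter (isValue? h) (allFin k)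

  value∈values : ∀ {h y} → IsValue h y → y ∈ values h
  value∈values {h} {y} = ∈-filter⁺ (isValue? h) (∈-allFin y)

  values-IsValue : ∀ {h y} → y ∈ values h → IsValue h y
  values-IsValue {h} y∈ = proj₂ (∈-filter⁻ (isValue? h) {xs = allFin k} y∈)

  Rng-∘-injective : ∀ {h g : P m k} (φ : Fin k → Fin k) → Injective _≡_ _≡_ φ →
    (∀ x → g x ≡ φ (h x)) → Rng g ≡ Rng h
  Rng-∘-injective {h} {g} φ φ-injective g≗φ∘h = ≤-antisym
    (Unique⇒length-≤ {R = λ z y → φ y ≡ z} (unique g) preimage (λ e e′ → trans (sym e) e′))
    (Unique⇒length-≤ {R = λ y z → φ y ≡ z} (unique h) image (λ e e′ → φ-injective (trans e (sym e′))))
    where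
    unique : ∀ h → Unique (values h)
    unique h = filter⁺ _ (allFin⁺ k)

    image : ∀ {y} → y ∈ values h → ∃ λ z → z ∈ values g × φ y ≡ z
    image {y} y∈ = φ y , value∈values (Any.map g≡φy (values-IsValue y∈)) , refl
      where
      g≡φy : ∀ {x} → h x ≡ y → g x ≡ φ y
      g≡φy {x} hx≡y = trans (g≗φ∘h x) (cong φ hx≡y)

    preimage : ∀ {z} → z ∈ values g → ∃ λ y → y ∈ values h × φ y ≡ z
    preimage z∈ with find (values-IsValue z∈)
    ... | x , x∈ , gx≡z = h x , value∈values (lose x∈ refl) , trans (sym (g≗φ∘h x)) gx≡z

%≡%⇒∣∸ : ∀ {k} .{{_ : NonZero k}} m n → m % k ≡ n % k → k ∣ n ∸ m
%≡%⇒∣∸ {k} m n e = divides (n / k ∸ m / k) (begin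
    n ∸ m                                      ≡⟨ cong₂ _∸_ (m≡m%n+[m/n]*n n k) (m≡m%n+[m/n]*n m k) ⟩
    (n % k + n / k * k) ∸ (m % k + m / k * k)  ≡⟨ cong (λ r → (n % k + n / k * k) ∸ (r + m / k * k)) e ⟩
    (n % k + n / k * k) ∸ (n % k + m / k * k)  ≡⟨ [m+n]∸[m+o]≡n∸o (n % k) _ _ ⟩
    n / k * k ∸ m / k * k                      ≡⟨ sym (*-distribʳ-∸ k (n / k) (m / k)) ⟩
    (n / k ∸ m / k) * k                        ∎)
  where open ≡-Reasoning

∣∧<⇒≡0 : ∀ {k m} .{{_ : NonZero k}} → k ∣ m → m < k → m ≡ 0
∣∧<⇒≡0 {k} {m} k∣m m<k = trans (sym (m<n⇒m%n≡m m<k)) (n∣m⇒m%n≡0 m k k∣m)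

+-*-%-cancel-≤ : ∀ {k} .{{_ : NonZero k}} s a {m n} → Coprime k a → n < k →
  (s + a * m) % k ≡ (s + a * n) % k → n ≤ m
+-*-%-cancel-≤ {k} s a {m} {n} coprime n<k e =
  m∸n≡0⇒m≤n (∣∧<⇒≡0 k∣n∸m (≤-<-trans (m∸n≤m n m) n<k))
  where
  difference : (s + a * n) ∸ (s + a * m) ≡ a * (n ∸ m)
  difference = trans ([m+n]∸[m+o]≡n∸o s _ _) (sym (*-distribˡ-∸ a n m))

  k∣n∸m : k ∣ n ∸ m
  k∣n∸m = coprime-divisor coprime (subst (k ∣_) difference (%≡%⇒∣∸ _ _ e))

affineMod : ∀ {k} .{{_ : NonZero k}} → ℕ → ℕ → Fin k → Fin k
affineMod {k} s a y = (s + a * toℕ y) mod k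

affineMod-injective : ∀ {k} .{{_ : NonZero k}} s a → Coprime k a →
  Injective _≡_ _≡_ (affineMod {k} s a)
affineMod-injective {k} s a coprime {y} {y′} e = toℕ-injective (≤-antisym
    (+-*-%-cancel-≤ s a coprime (toℕ<n y) (sym e%))
    (+-*-%-cancel-≤ s a coprime (toℕ<n y′) e%))
  where
  e% : (s + a * toℕ y) % k ≡ (s + a * toℕ y′) % k
  e% = fromℕ<-injective _ _ (m%n<n _ k) (m%n<n _ k) e

sum-[]≔ : ∀ {n} (xs : Vec ℕ n) i x → Vec.sum (xs [ i ]≔ x) ≡ Vec.sum (xs [ i ]≔ 0) + x
sum-[]≔ (y ∷ xs) zero    x = +-comm x (Vec.sum xs)
sum-[]≔ (y ∷ xs) (suc i) x = trans (cong (y +_) (sum-[]≔ xs i x)) (sym (+-assoc y _ x))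

tabulate-lookup-[]≔ : ∀ {A B : Set} {n} (G : Fin n → A → B) (xs : Vec A n) i x →
  tabulate (λ j → G j (Vec.lookup (xs [ i ]≔ x) j))
    ≡ tabulate (λ j → G j (Vec.lookup xs j)) [ i ]≔ G i x
tabulate-lookup-[]≔ G (y ∷ xs) zero    x = refl
tabulate-lookup-[]≔ G (y ∷ xs) (suc i) x = cong (G zero y ∷_) (tabulate-lookup-[]≔ (G ∘ suc) xs i x)

module _ {k n : ℕ} .{{_ : NonZero k}} (a : Fin n → Fin k) (fs : Fin n → P 1 k) where

  term : Fin n → Fin k → ℕ
  term j v = toℕ (a j) * toℕ (fs j (v ∷ []))

  terms : Vec (Fin k) n → Vec ℕ n
  terms x = tabulate (λ j → term j (Vec.lookup x j))

  subfun-linComb : ∀ i c x →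
    subfun (linComb a fs) i c x ≡ affineMod (Vec.sum (terms c [ i ]≔ 0)) (toℕ (a i)) (fs i x)
  subfun-linComb i c (t ∷ []) = cong (_mod k) (begin
    Vec.sum (terms (c [ i ]≔ t))              ≡⟨ cong Vec.sum (tabulate-lookup-[]≔ term c i t) ⟩
    Vec.sum (terms c [ i ]≔ term i t)         ≡⟨ sum-[]≔ (terms c) i (term i t) ⟩
    Vec.sum (terms c [ i ]≔ 0) + term i t     ∎)
    where open ≡-Reasoning

  Rng-subfun-linComb : ∀ i → Coprime k (toℕ (a i)) → ∀ c →
    Rng (subfun (linComb a fs) i c) ≡ Rng (fs i)
  Rng-subfun-linComb i coprime c =
    Rng-∘-injective (affineMod s (toℕ (a i))) (affineMod-injective s (toℕ (a i)) coprime) (subfun-linComb i c)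
    where s = Vec.sum (terms c [ i ]≔ 0)

Rng-subfun-constant⇒SprIsSingleton : ∀ {k n} {f : P n k} {i q} → Vec (Fin k) n →
  (∀ c → Rng (subfun f i c) ≡ q) → SprIsSingleton f i q
Rng-subfun-constant⇒SprIsSingleton c₀ Rng≡q r =
  (λ (c , Rng≡r) → trans (sym Rng≡r) (Rng≡q c)) , λ { refl → c₀ , Rng≡q c₀ }

-- Only Rng (fs i) ≡ q i and the coprimality of the a i are needed; the bounds
-- on k, n and q are redundant.
corollary2p3 : (k n : ℕ) → .{{_ : NonZero k}} → 2 ≤ k → 2 ≤ n →
    (q : Fin n → ℕ) → (∀ i → 1 ≤ q i) → (∀ i → q i ≤ k) →
    (fs : Fin n → P 1 k) → (∀ i → Rng (fs i) ≡ q i) →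
    (a : Fin n → Fin k) → (∀ i → gcd (toℕ (a i)) k ≡ 1) →
    IsQH q (linComb a fs)
corollary2p3 k n _ _ q _ _ fs Rng-fs a gcd≡1 i =
  Rng-subfun-constant⇒SprIsSingleton (replicate n (0 mod k)) λ c →
    trans (Rng-subfun-linComb a fs i (Coprime.sym (gcd≡1⇒coprime (gcd≡1 i))) c) (Rng-fs i)
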